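{- Let $r\ge 3$, $t\ge 1$, and let $\mathcal{K}_n^r(t)$ be the complete $r$-uniform $n$-partite hypergraph with parts $V_1,\dots,V_n$, where $|V_i|=t$ for $1\le i\le n$. If $n>2(r-1)^2$, then $\chi^{e}(\mathcal{K}_n^r(t))=2$.
   Context: A hypergraph $\mathcal{H}=(V,E)$ has a finite nonempty vertex set $V$ and a collection $E$ of distinct nonempty subsets of $V$ (edges); it is $r$-uniform if every edge has size $r$. The complete $r$-uniform $n$-partite hypergraph $\mathcal{K}_n^r(t)$ has vertex set $V_1\cup\dots\cup V_n$ (disjoint parts of size $t$) and as edges all $r$-subsets containing at most one vertex from each part. For an edge weighting $w:E(\mathcal{H})\to\{1,\dots,k\}$ put $\sigma^{e}(v)=\sum_{e\ni v}w(e)$. A vertex coloring of a hypergraph is proper if every edge contains two vertices of distinct colors. $\chi^{e}(\mathcal{H})$ is the minimum $k$ such that some $w:E(\mathcal{H})\to\{1,\dots,k\}$ makes $\sigma^{e}$ a proper vertex coloring. -}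

module Defs where

open import Data.Nat using (ℕ; zero; suc; _+_; _≤_; _<_)
open import Data.Nat.Properties using () renaming (_≟_ to _≟ℕ_)
open import Data.Fin using (Fin) renaming (_≟_ to _≟F_)
open import Data.Fin.Base using ()
open import Data.Maybe using (Maybe; just; nothing)
open import Data.Maybe.Properties using (≡-dec)
open import Data.Vec using (Vec; []; _∷_; lookup)
open import Data.List using (List; []; _∷_; [_]; map; concatMap)
open import Data.Nat.ListAction using (sum)
open import Data.List.Base using (allFin)
open import Data.Product using (Σ; ∃; _×_; _,_; proj₁)
open import Data.Bool using (if_then_else_)
open import Relation.Nullary using (¬_; yes; no)
open import Relation.Nullary.Decidable using (isYes)
open import Relation.Binary.PropositionalEquality using (_≡_; _≢_)

-- Vertices: pairs (i , j) : Fin n × Fin t, i.e. the j-th vertex of part V_i.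
-- An edge is encoded (bijectively) by a vector e : Vec (Maybe (Fin t)) n with
-- exactly r entries of the form 'just _': vertex (i , j) lies in e iff e[i] = just j.
-- Such vectors are exactly the r-subsets meeting each part in at most one vertex.

Vertex : ℕ → ℕ → Set
Vertex n t = Fin n × Fin t

countJust : ∀ {t n} → Vec (Maybe (Fin t)) n → ℕ
countJust []             = 0
countJust (nothing ∷ v)  = countJust v
countJust (just _ ∷ v)   = suc (countJust v)

Edge : ℕ → ℕ → ℕ → Set
Edge n r t = Σ (Vec (Maybe (Fin t)) n) (λ e → countJust e ≡ r)

_∈E_ : ∀ {n r t} → Vertex n t → Edge n r t → Set
(i , j) ∈E (e , _) = lookup e i ≡ just j

allVecs : (t n : ℕ) → List (Vec (Maybe (Fin t)) n)
allVecs t zero    = [ [] ]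
allVecs t (suc n) =
  concatMap (λ v → map (_∷ v) (nothing ∷ map just (allFin t))) (allVecs t n)

keepEdge : ∀ {n t} (r : ℕ) → Vec (Maybe (Fin t)) n → List (Edge n r t)
keepEdge r e with countJust e ≟ℕ r
... | yes p = [ (e , p) ]
... | no  _ = []

-- the list of all edges of K_n^r(t), each listed exactly once
edges : (n r t : ℕ) → List (Edge n r t)
edges n r t = concatMap (keepEdge r) (allVecs t n)

σe : ∀ {n r t} → (Edge n r t → ℕ) → Vertex n t → ℕ
σe {n} {r} {t} w (i , j) =
  sum (map (λ e → if isYes (≡-dec _≟F_ (lookup (proj₁ e) i) (just j)) then w e else 0)
           (edges n r t))

ProperColouring : ∀ {n r t} {C : Set} → (Vertex n t → C) → Set
ProperColouring {n} {r} {t} c =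
  (e : Edge n r t) → Σ (Vertex n t) λ u → Σ (Vertex n t) λ v →
    (u ∈E e) × (v ∈E e) × (c u ≢ c v)

IsWeighting : ∀ {n r t} → ℕ → (Edge n r t → ℕ) → Set
IsWeighting {n} {r} {t} k w = (e : Edge n r t) → (1 ≤ w e) × (w e ≤ k)

HasProperWeighting : (n r t k : ℕ) → Set
HasProperWeighting n r t k =
  Σ (Edge n r t → ℕ) λ w → IsWeighting k w × ProperColouring {n} {r} {t} (σe w)

ChiE≡ : (n r t k : ℕ) → Set
ChiE≡ n r t k = HasProperWeighting n r t k × (∀ m → m < k → ¬ HasProperWeighting n r t m)

-- When a new part is added and all edges through it get one weight b, every old vertex
-- gains the same amount (the hypergraph is regular), so old edges stay properly coloured. On an edge through
-- a new vertex x and an old vertex y, σ(x) − σ(y) = b·deg(y) − σ_old(y), which is nonzero as soon as y lies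
-- on an old edge of weight ≠ b. Alternating b between consecutive steps preserves this side condition, and
-- the induction starts from an explicit weighting of K_{r+1}^r(t). The lower bound holds because with a
-- single weight σ^e is a multiple of the degree, which is constant.

module Submission where

open import Defs
open import Data.Nat using (ℕ; zero; suc; _+_; _*_; _∸_; _≤_; _<_; z≤n; s≤s)
open import Data.Nat.Properties
open import Data.Nat.ListAction using (sum)
open import Data.Nat.ListAction.Properties using (sum-++)
open import Algebra.Properties.CommutativeSemigroup +-commutativeSemigroup using (interchange)
open import Data.Fin using (Fin; zero; suc; fromℕ<) renaming (_≟_ to _≟F_)
open import Data.Fin.Properties using (toℕ<n)
open import Data.Maybe using (Maybe; just; nothing)
open import Data.Maybe.Properties using (≡-dec)
open import Data.Vec using (Vec; []; _∷_; lookup)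
open import Data.List using (List; []; _∷_; _++_; map; concatMap; allFin)
open import Data.List.Properties using (map-++; map-∘; map-cong; map-tabulate)
open import Data.List.Membership.Propositional using (_∈_)
open import Data.List.Membership.Propositional.Properties using (∈-map⁺; ∈-concatMap⁺; ∈-allFin)
open import Data.List.Relation.Unary.Any as Any using (here; there)
open import Data.Product using (Σ; _×_; _,_; proj₁; proj₂)
open import Data.Sum using (inj₁; inj₂)
open import Data.Bool using (Bool; true; false; not; if_then_else_)
open import Data.Bool.Properties using (if-eta; not-¬)
open import Data.Empty using (⊥-elim)
open import Function using (_∘_; id)
open import Relation.Nullary using (¬_; does; yes; no)
open import Relation.Nullary.Decidable using (isYes; isYes≗does; dec-true; dec-false)
open import Relation.Binary.PropositionalEquality
  using (_≡_; _≢_; _≗_; refl; sym; trans; cong; cong₂; subst; subst₂; module ≡-Reasoning)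

private variable
  A B : Set
  N k r : ℕ

sumMap : (A → ℕ) → List A → ℕ
sumMap f xs = sum (map f xs)

sumMap-cong : {f g : A → ℕ} → f ≗ g → ∀ xs → sumMap f xs ≡ sumMap g xs
sumMap-cong f≗g xs = cong sum (map-cong f≗g xs)

sumMap-zero : (xs : List A) → sumMap (λ _ → 0) xs ≡ 0
sumMap-zero []       = refl
sumMap-zero (_ ∷ xs) = sumMap-zero xs

sumMap-+ : (f g : A → ℕ) (xs : List A) →
          sumMap (λ x → f x + g x) xs ≡ sumMap f xs + sumMap g xs
sumMap-+ f g []       = refl
sumMap-+ f g (x ∷ xs) = trans (cong (f x + g x +_) (sumMap-+ f g xs)) (interchange (f x) (g x) _ _)

sumMap-map : (f : B → ℕ) (g : A → B) (xs : List A) → sumMap f (map g xs) ≡ sumMap (f ∘ g) xs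
sumMap-map f g xs = cong sum (sym (map-∘ xs))

sumMap-concatMap : (f : B → ℕ) (g : A → List B) (xs : List A) →
                   sumMap f (concatMap g xs) ≡ sumMap (sumMap f ∘ g) xs
sumMap-concatMap f g []       = refl
sumMap-concatMap f g (x ∷ xs) = begin
  sum (map f (g x ++ concatMap g xs))          ≡⟨ cong sum (map-++ f (g x) _) ⟩
  sum (map f (g x) ++ map f (concatMap g xs))  ≡⟨ sum-++ (map f (g x)) _ ⟩
  sumMap f (g x) + sumMap f (concatMap g xs)   ≡⟨ cong (sumMap f (g x) +_) (sumMap-concatMap f g xs) ⟩
  sumMap (sumMap f ∘ g) (x ∷ xs)               ∎
  where open ≡-Reasoning

sumMap-swap : (f : A → B → ℕ) (xs : List A) (ys : List B) →
              sumMap (λ x → sumMap (f x) ys) xs ≡ sumMap (λ y → sumMap (λ x → f x y) xs) ys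
sumMap-swap f []       ys = sym (sumMap-zero ys)
sumMap-swap f (x ∷ xs) ys =
  trans (cong (sumMap (f x) ys +_) (sumMap-swap f xs ys)) (sym (sumMap-+ (f x) _ ys))

sumMap-mono-≤ : {f g : A → ℕ} → (∀ x → f x ≤ g x) → ∀ xs → sumMap f xs ≤ sumMap g xs
sumMap-mono-≤ f≤g []       = z≤n
sumMap-mono-≤ f≤g (x ∷ xs) = +-mono-≤ (f≤g x) (sumMap-mono-≤ f≤g xs)

sumMap-mono-< : {f g : A → ℕ} → (∀ x → f x ≤ g x) →
                ∀ {x xs} → x ∈ xs → f x < g x → sumMap f xs < sumMap g xs
sumMap-mono-< f≤g {xs = _ ∷ xs} (here refl)  fx<gx = +-mono-<-≤ fx<gx (sumMap-mono-≤ f≤g xs)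
sumMap-mono-< f≤g {xs = y ∷ _}  (there x∈xs) fx<gx =
  +-mono-≤-< (f≤g y) (sumMap-mono-< f≤g x∈xs fx<gx)

sumMap-allFin-suc : ∀ {n} (f : Fin (suc n) → ℕ) →
                    sumMap f (allFin (suc n)) ≡ f zero + sumMap (f ∘ suc) (allFin n)
sumMap-allFin-suc f =
  cong (f zero +_) (cong sum (trans (map-tabulate suc f) (sym (map-tabulate id (f ∘ suc)))))

sumMap-allFin-indicator : ∀ {n} (j : Fin n) (g : Fin n → ℕ) →
                          sumMap (λ x → if does (x ≟F j) then g x else 0) (allFin n) ≡ g j
sumMap-allFin-indicator {suc n} zero    g =
  trans (sumMap-allFin-suc (λ x → if does (x ≟F zero) then g x else 0))
        (trans (cong (g zero +_) (sumMap-zero (allFin n))) (+-identityʳ _))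
sumMap-allFin-indicator {suc n} (suc j) g =
  trans (sumMap-allFin-suc (λ x → if does (x ≟F suc j) then g x else 0))
        (sumMap-allFin-indicator j (g ∘ suc))

if-then-mono : ∀ b {x y} → x ≤ y → (if b then x else 0) ≤ (if b then y else 0)
if-then-mono true  x≤y = x≤y
if-then-mono false _   = z≤n

module Transversals (t : ℕ) where

  Transversal : ℕ → Set
  Transversal N = Vec (Maybe (Fin t)) N

  sumFin : (Fin t → ℕ) → ℕ
  sumFin f = sumMap f (allFin t)

  Σᵗ : (Transversal N → ℕ) → ℕ
  Σᵗ {N} f = sumMap f (allVecs t N)

  ∈-allVecs : (v : Transversal N) → v ∈ allVecs t N
  ∈-allVecs []      = here refl
  ∈-allVecs (x ∷ v) =
    ∈-concatMap⁺ _ (Any.map (λ { refl → ∈-map⁺ (_∷ v) (∈-heads x) }) (∈-allVecs v))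
    where
    ∈-heads : ∀ x → x ∈ nothing ∷ map just (allFin t)
    ∈-heads nothing  = here refl
    ∈-heads (just j) = there (∈-map⁺ just (∈-allFin j))

  Σᵗ-suc : (f : Transversal (suc N) → ℕ) →
           Σᵗ f ≡ Σᵗ (λ v → f (nothing ∷ v) + sumFin (λ j → f (just j ∷ v)))
  Σᵗ-suc {N} f = trans (sumMap-concatMap f _ (allVecs t N)) (sumMap-cong by-head (allVecs t N))
    where
    by-head : ∀ v → sumMap f (map (_∷ v) (nothing ∷ map just (allFin t))) ≡
                    f (nothing ∷ v) + sumFin (λ j → f (just j ∷ v))
    by-head v = cong (f (nothing ∷ v) +_) (trans (sumMap-map f (_∷ v) (map just (allFin t)))
                                                 (sumMap-map (λ x → f (x ∷ v)) just (allFin t)))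

  Σᵗ-cong : {f g : Transversal N → ℕ} → f ≗ g → Σᵗ f ≡ Σᵗ g
  Σᵗ-cong {N} f≗g = sumMap-cong f≗g (allVecs t N)

  -- Weightings are defined on all transversals: total N k W sums W over the edges of K_N^k(t),
  -- and degree k u W over those containing u, i.e. it is σ^e(u) for the weighting W.
  layer : ℕ → (Transversal N → ℕ) → Transversal N → ℕ
  layer k W v = if does (countJust v ≟ k) then W v else 0

  through : Vertex N t → (Transversal N → ℕ) → Transversal N → ℕ
  through (i , j) W v = if does (≡-dec _≟F_ (lookup v i) (just j)) then W v else 0

  total : (N k : ℕ) → (Transversal N → ℕ) → ℕ
  total N k W = Σᵗ (layer k W)

  degree : ℕ → Vertex N t → (Transversal N → ℕ) → ℕ
  degree {N} k u W = total N k (through u W)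

  total-suc : ∀ k (W : Transversal (suc N) → ℕ) →
              total (suc N) (suc k) W ≡
              total N (suc k) (W ∘ (nothing ∷_)) + sumFin (λ j → total N k (W ∘ (just j ∷_)))
  total-suc {N} k W = begin
    total (suc N) (suc k) W
      ≡⟨ Σᵗ-suc (layer (suc k) W) ⟩
    Σᵗ (λ v → layer (suc k) (W ∘ (nothing ∷_)) v + sumFin (λ j → layer k (W ∘ (just j ∷_)) v))
      ≡⟨ sumMap-+ _ _ (allVecs t N) ⟩
    total N (suc k) (W ∘ (nothing ∷_)) + Σᵗ (λ v → sumFin (λ j → layer k (W ∘ (just j ∷_)) v))
      ≡⟨ cong (total N (suc k) (W ∘ (nothing ∷_)) +_) (sumMap-swap _ (allVecs t N) (allFin t)) ⟩
    total N (suc k) (W ∘ (nothing ∷_)) + sumFin (λ j → total N k (W ∘ (just j ∷_))) ∎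
    where open ≡-Reasoning

  total-zero : (W : Transversal (suc N) → ℕ) → total (suc N) 0 W ≡ total N 0 (W ∘ (nothing ∷_))
  total-zero W = trans (Σᵗ-suc (layer 0 W)) (Σᵗ-cong λ v →
    trans (cong (layer 0 (W ∘ (nothing ∷_)) v +_) (sumMap-zero (allFin t))) (+-identityʳ _))

  total-null : ∀ N k → total N k (λ _ → 0) ≡ 0
  total-null N k =
    trans (sumMap-cong (λ v → if-eta (does (countJust v ≟ k))) (allVecs t N)) (sumMap-zero (allVecs t N))

  total-if : ∀ k b (W : Transversal N → ℕ) →
             total N k (λ v → if b then W v else 0) ≡ (if b then total N k W else 0)
  total-if     k true  W = refl
  total-if {N} k false W = total-null N k

  degree-head : ∀ k j (W : Transversal (suc N) → ℕ) →
                degree (suc k) (zero , j) W ≡ total N k (W ∘ (just j ∷_))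
  degree-head {N} k j W = begin
    degree (suc k) (zero , j) W
      ≡⟨ total-suc k (through (zero , j) W) ⟩
    total N (suc k) (λ _ → 0) +
    sumFin (λ j₀ → total N k (λ v → if does (j₀ ≟F j) then W (just j₀ ∷ v) else 0))
      ≡⟨ cong₂ _+_ (total-null N (suc k))
                   (sumMap-cong (λ j₀ → total-if {N} k (does (j₀ ≟F j)) _) (allFin t)) ⟩
    sumFin (λ j₀ → if does (j₀ ≟F j) then total N k (W ∘ (just j₀ ∷_)) else 0)
      ≡⟨ sumMap-allFin-indicator j (λ j₀ → total N k (W ∘ (just j₀ ∷_))) ⟩
    total N k (W ∘ (just j ∷_)) ∎
    where open ≡-Reasoning

  degree-suc : ∀ k i j (W : Transversal (suc N) → ℕ) →
               degree (suc k) (suc i , j) W ≡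
               degree (suc k) (i , j) (W ∘ (nothing ∷_)) +
               sumFin (λ j₀ → degree k (i , j) (W ∘ (just j₀ ∷_)))
  degree-suc k i j W = total-suc k (through (suc i , j) W)

  degree-zero : (u : Vertex N t) (W : Transversal N → ℕ) → degree 0 u W ≡ 0
  degree-zero {suc N} (zero  , j) W = trans (total-zero (through (zero , j) W)) (total-null N 0)
  degree-zero         (suc i , j) W = trans (total-zero (through (suc i , j) W)) (degree-zero (i , j) _)

  degree-regular : ∀ k (u : Vertex (suc N) t) h → degree (suc k) u (λ _ → h) ≡ total N k (λ _ → h)
  degree-regular {N} k (zero , j) h = degree-head {N} k j (λ _ → h)
  degree-regular {zero} k (suc () , j) h
  degree-regular {suc N} zero (suc i , j) h = begin
    degree 1 (suc i , j) (λ _ → h)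
      ≡⟨ degree-suc 0 i j (λ _ → h) ⟩
    degree 1 (i , j) (λ _ → h) + sumFin (λ _ → degree 0 (i , j) (λ _ → h))
      ≡⟨ cong₂ _+_ (degree-regular zero (i , j) h)
                   (trans (sumMap-cong (λ _ → degree-zero (i , j) (λ _ → h)) (allFin t))
                          (sumMap-zero (allFin t))) ⟩
    total N 0 (λ _ → h) + 0
      ≡⟨ +-identityʳ _ ⟩
    total N 0 (λ _ → h)
      ≡⟨ sym (total-zero {N} (λ _ → h)) ⟩
    total (suc N) 0 (λ _ → h) ∎
    where open ≡-Reasoning
  degree-regular {suc N} (suc k) (suc i , j) h = begin
    degree (suc (suc k)) (suc i , j) (λ _ → h)
      ≡⟨ degree-suc (suc k) i j (λ _ → h) ⟩
    degree (suc (suc k)) (i , j) (λ _ → h) + sumFin (λ _ → degree (suc k) (i , j) (λ _ → h))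
      ≡⟨ cong₂ _+_ (degree-regular (suc k) (i , j) h)
                   (sumMap-cong (λ _ → degree-regular k (i , j) h) (allFin t)) ⟩
    total N (suc k) (λ _ → h) + sumFin (λ _ → total N k (λ _ → h))
      ≡⟨ sym (total-suc {N} k (λ _ → h)) ⟩
    total (suc N) (suc k) (λ _ → h) ∎
    where open ≡-Reasoning

  degree-uniform : ∀ k (u u′ : Vertex N t) h → degree k u (λ _ → h) ≡ degree k u′ (λ _ → h)
  degree-uniform zero u u′ h = trans (degree-zero u (λ _ → h)) (sym (degree-zero u′ (λ _ → h)))
  degree-uniform {zero} (suc k) (() , _) u′ h
  degree-uniform {suc N} (suc k) u u′ h = trans (degree-regular k u h) (sym (degree-regular k u′ h))

  -- A (k+1)-edge either avoids the part of u, and then becomes a (k+2)-edge through u when u is added,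
  -- or meets that part in one of its t vertices.
  total-split : ∀ k (u : Vertex N t) h →
                total N (suc k) (λ _ → h) ≡
                degree (suc (suc k)) u (λ _ → h) + sumFin (λ _ → degree (suc k) u (λ _ → h))
  total-split {suc N} k u h = trans (total-suc {N} k (λ _ → h))
    (sym (cong₂ _+_ (degree-regular (suc k) u h) (sumMap-cong (λ _ → degree-regular k u h) (allFin t))))

  restrict-on-edge : {W : Transversal N → ℕ} {u : Vertex N t} (e : Edge N k t) → u ∈E e →
                layer k (through u W) (proj₁ e) ≡ W (proj₁ e)
  restrict-on-edge {k = k} {W} {i , j} (v , |v|≡k) u∈e =
    trans (cong (λ b → if b then through (i , j) W v else 0) (dec-true (countJust v ≟ k) |v|≡k))
          (cong (λ b → if b then W v else 0) (dec-true (≡-dec _≟F_ (lookup v i) (just j)) u∈e))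

  restrict-mono : {W W′ : Transversal N → ℕ} {u : Vertex N t} → (∀ v → W v ≤ W′ v) →
                  ∀ v → layer k (through u W) v ≤ layer k (through u W′) v
  restrict-mono {k = k} {u = i , j} W≤W′ v =
    if-then-mono (does (countJust v ≟ k))
                 (if-then-mono (does (≡-dec _≟F_ (lookup v i) (just j))) (W≤W′ v))

  degree-< : {W W′ : Transversal N → ℕ} {u : Vertex N t} → (∀ v → W v ≤ W′ v) →
             (e : Edge N k t) → u ∈E e → W (proj₁ e) < W′ (proj₁ e) → degree k u W < degree k u W′
  degree-< {W = W} {W′} W≤W′ e u∈e lt =
    sumMap-mono-< (restrict-mono W≤W′) (∈-allVecs (proj₁ e))
                  (subst₂ _<_ (sym (restrict-on-edge {W = W} e u∈e))
                              (sym (restrict-on-edge {W = W′} e u∈e)) lt)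

  cons : Fin t → Edge N k t → Edge (suc N) (suc k) t
  cons j (v , |v|≡k) = just j ∷ v , cong suc |v|≡k

  skip : Edge N k t → Edge (suc N) k t
  skip (v , |v|≡k) = nothing ∷ v , |v|≡k

  edge-of-size : k ≤ N → Fin t → Edge N k t
  edge-of-size {N = zero}  z≤n       j = [] , refl
  edge-of-size {N = suc N} z≤n       j = skip (edge-of-size z≤n j)
  edge-of-size             (s≤s k≤N) j = cons j (edge-of-size k≤N j)

  edge-through : 1 ≤ k → k ≤ N → (u : Vertex N t) → Σ (Edge N k t) (u ∈E_)
  edge-through (s≤s z≤n) (s≤s k≤N) (zero , j) = cons j (edge-of-size k≤N j) , refl
  edge-through {k = 1} (s≤s z≤n) _ (suc i , j) =
    let e , u∈e = edge-through ≤-refl (≤-trans (s≤s z≤n) (toℕ<n i)) (i , j) in skip e , u∈e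
  edge-through {k = suc (suc k)} (s≤s z≤n) (s≤s k≤N) (suc i , j) =
    let e , u∈e = edge-through (s≤s z≤n) k≤N (i , j) in cons j e , u∈e

  vertex-of : (e : Edge N (suc k) t) → Σ (Vertex N t) (_∈E e)
  vertex-of (just j ∷ v  , _)     = (zero , j) , refl
  vertex-of (nothing ∷ v , |v|≡k) = let (i , j) , u∈e = vertex-of (v , |v|≡k) in (suc i , j) , u∈e

  vertex-off-head : (e : Edge (suc N) (suc (suc k)) t) →
                    Σ (Vertex N t) λ (i , j) → (suc i , j) ∈E e
  vertex-off-head (nothing ∷ v , |v|≡k) = vertex-of (v , |v|≡k)
  vertex-off-head (just _ ∷ v  , |v|≡k) = vertex-of (v , suc-injective |v|≡k)

  countJust-≤ : (v : Transversal N) → countJust v ≤ N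
  countJust-≤ []            = z≤n
  countJust-≤ (nothing ∷ v) = m≤n⇒m≤1+n (countJust-≤ v)
  countJust-≤ (just _ ∷ v)  = s≤s (countJust-≤ v)

  full-edge-head : (e : Edge (suc N) (suc N) t) → Σ (Fin t) λ j → (zero , j) ∈E e
  full-edge-head (just j ∷ _  , _)     = j , refl
  full-edge-head (nothing ∷ v , |v|≡N) = ⊥-elim (1+n≰n (subst (_≤ _) |v|≡N (countJust-≤ v)))

  σe≡degree : (w : Edge N r t → ℕ) (W : Transversal N → ℕ) → (∀ e → w e ≡ W (proj₁ e)) →
              ∀ u → σe w u ≡ degree r u W
  σe≡degree {N} {r} w W w≗W (i , j) =
    trans (sumMap-concatMap _ (keepEdge r) (allVecs t N)) (Σᵗ-cong per-transversal)
    where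
    per-transversal : ∀ v →
      sumMap (λ e → if isYes (≡-dec _≟F_ (lookup (proj₁ e) i) (just j)) then w e else 0) (keepEdge r v) ≡
      (if does (countJust v ≟ r) then through (i , j) W v else 0)
    per-transversal v with countJust v ≟ r
    ... | yes |v|≡r = begin
      (if isYes (≡-dec _≟F_ (lookup v i) (just j)) then w (v , |v|≡r) else 0) + 0
        ≡⟨ +-identityʳ _ ⟩
      (if isYes (≡-dec _≟F_ (lookup v i) (just j)) then w (v , |v|≡r) else 0)
        ≡⟨ cong₂ (λ b x → if b then x else 0) (isYes≗does _) (w≗W (v , |v|≡r)) ⟩
      through (i , j) W v
        ≡⟨ cong (λ b → if b then through (i , j) W v else 0) (dec-true (countJust v ≟ r) |v|≡r) ⟨
      (if does (countJust v ≟ r) then through (i , j) W v else 0) ∎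
      where open ≡-Reasoning
    ... | no |v|≢r =
      cong (λ b → if b then through (i , j) W v else 0) (sym (dec-false (countJust v ≟ r) |v|≢r))

  no-proper-weighting-below-2 : Fin t → r ≤ N → ∀ {k} → k < 2 → ¬ HasProperWeighting N r t k
  no-proper-weighting-below-2 j r≤N {0} _ (w , w-range , _) =
    let 1≤w , w≤0 = w-range (edge-of-size r≤N j) in 1+n≰n (≤-trans 1≤w w≤0)
  no-proper-weighting-below-2 {r} j r≤N {1} _ (w , w-range , proper) =
    let u , u′ , _ , _ , σu≢σu′ = proper (edge-of-size r≤N j)
    in σu≢σu′ (begin
      σe w u                  ≡⟨ σe≡degree w (λ _ → 1) w≡1 u ⟩
      degree r u (λ _ → 1)    ≡⟨ degree-uniform r u u′ 1 ⟩
      degree r u′ (λ _ → 1)   ≡⟨ σe≡degree w (λ _ → 1) w≡1 u′ ⟨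
      σe w u′                 ∎)
    where
    open ≡-Reasoning
    w≡1 : ∀ e → w e ≡ 1
    w≡1 e = ≤-antisym (proj₂ (w-range e)) (proj₁ (w-range e))
  no-proper-weighting-below-2 j r≤N {suc (suc _)} (s≤s (s≤s ()))

module Weighting (t : ℕ) where

  open Transversals t

  weight : Bool → ℕ
  weight false = 1
  weight true  = 2

  weight-false≤ : ∀ x → weight false ≤ weight x
  weight-false≤ false = ≤-refl
  weight-false≤ true  = s≤s z≤n

  weight≤true : ∀ x → weight x ≤ weight true
  weight≤true false = s≤s z≤n
  weight≤true true  = ≤-refl

  weight-false< : ∀ {x} → x ≢ false → weight false < weight x
  weight-false< {false} x≢false = ⊥-elim (x≢false refl)
  weight-false< {true}  _       = ≤-refl

  weight<true : ∀ {x} → x ≢ true → weight x < weight true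
  weight<true {false} _      = ≤-refl
  weight<true {true}  x≢true = ⊥-elim (x≢true refl)

  degree-≢-uniform : ∀ {b} (B : Transversal N → Bool) {u : Vertex N t} (e : Edge N k t) →
                     u ∈E e → B (proj₁ e) ≢ b → degree k u (weight ∘ B) ≢ degree k u (λ _ → weight b)
  degree-≢-uniform {b = false} B e u∈e Be≢b =
    >⇒≢ (degree-< (weight-false≤ ∘ B) e u∈e (weight-false< Be≢b))
  degree-≢-uniform {b = true}  B e u∈e Be≢b =
    <⇒≢ (degree-< (weight≤true ∘ B) e u∈e (weight<true Be≢b))

  extend : (Transversal N → A) → (Transversal N → A) → Transversal (suc N) → A
  extend F G (nothing ∷ v) = F v
  extend F G (just _ ∷ v)  = G v

  Avoidable : ∀ {N} r → (Transversal N → Bool) → Bool → Set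
  Avoidable {N} r B b = (u : Vertex N t) → Σ (Edge N r t) λ e → u ∈E e × B (proj₁ e) ≢ b

  -- An edge colouring whose weights (false ↦ 1, true ↦ 2) make σ^e proper, together with a spare colour
  -- that no vertex sees on all of its edges; the edges of the next part will be given the spare colour.
  record Extendable (r N : ℕ) : Set where
    field
      colour    : Transversal N → Bool
      spare     : Bool
      proper    : ProperColouring {N} {r} {t} (λ u → degree r u (weight ∘ colour))
      avoidable : Avoidable r colour spare

  -- Every old vertex gains the same amount from the new edges. By double counting, a new vertex's sum
  -- is that gain plus the sum an old vertex y would have if all old edges had weight b, and this differs
  -- from σ(y) because y lies on an old edge of the other weight.
  extend-proper : {B : Transversal N → Bool} {b : Bool} →
                  ProperColouring {N} {suc (suc k)} {t} (λ u → degree (suc (suc k)) u (weight ∘ B)) →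
                  Avoidable (suc (suc k)) B b →
                  ProperColouring {suc N} {suc (suc k)} {t}
                                  (λ u → degree (suc (suc k)) u (weight ∘ extend B (λ _ → b)))
  extend-proper {N} {k} {B} {b} proper avoidable = extended
    where
    H : Transversal N → ℕ
    H _ = weight b

    W′ : Transversal (suc N) → ℕ
    W′ = weight ∘ extend B (λ _ → b)

    σ : Vertex N t → ℕ
    σ u = degree (suc (suc k)) u (weight ∘ B)

    σ′ : Vertex (suc N) t → ℕ
    σ′ u = degree (suc (suc k)) u W′

    gain : Vertex N t → ℕ
    gain u = sumFin (λ _ → degree (suc k) u H)

    gain-uniform : ∀ u u′ → gain u ≡ gain u′
    gain-uniform u u′ = sumMap-cong (λ _ → degree-uniform (suc k) u u′ (weight b)) (allFin t)

    old-vertex : ∀ i j → σ′ (suc i , j) ≡ σ (i , j) + gain (i , j)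
    old-vertex i j = degree-suc (suc k) i j W′

    extended : ProperColouring {suc N} {suc (suc k)} {t} σ′
    extended (nothing ∷ v , |v|≡r) =
      let (i , j) , (i′ , j′) , u∈v , u′∈v , σu≢σu′ = proper (v , |v|≡r)
      in (suc i , j) , (suc i′ , j′) , u∈v , u′∈v , λ eq →
        σu≢σu′ (+-cancelʳ-≡ (gain (i , j)) _ _ (begin
        σ (i , j) + gain (i , j)     ≡⟨ old-vertex i j ⟨
        σ′ (suc i , j)               ≡⟨ eq ⟩
        σ′ (suc i′ , j′)             ≡⟨ old-vertex i′ j′ ⟩
        σ (i′ , j′) + gain (i′ , j′) ≡⟨ cong (σ (i′ , j′) +_) (gain-uniform (i′ , j′) (i , j)) ⟩
        σ (i′ , j′) + gain (i , j)   ∎))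
      where open ≡-Reasoning
    extended (just j₀ ∷ v , |v|≡r) =
      let (i , j) , u∈v = vertex-of (v , suc-injective |v|≡r)
          e , u∈e , Be≢b = avoidable (i , j)
      in (zero , j₀) , (suc i , j) , refl , u∈v , λ eq →
        degree-≢-uniform B e u∈e Be≢b (sym (+-cancelʳ-≡ (gain (i , j)) _ _ (begin
        degree (suc (suc k)) (i , j) H + gain (i , j) ≡⟨ total-split k (i , j) (weight b) ⟨
        total N (suc k) H                             ≡⟨ degree-head (suc k) j₀ W′ ⟨
        σ′ (zero , j₀)                                ≡⟨ eq ⟩
        σ′ (suc i , j)                                ≡⟨ old-vertex i j ⟩
        σ (i , j) + gain (i , j)                      ∎)))
      where open ≡-Reasoning

  extend-avoidable : suc k ≤ N → (B : Transversal N → Bool) (b : Bool) →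
                     Avoidable (suc (suc k)) (extend B (λ _ → b)) (not b)
  extend-avoidable k<N B b (zero  , j) = cons j (edge-of-size k<N j) , refl , not-¬ refl
  extend-avoidable k<N B b (suc i , j) =
    let e , u∈e = edge-through (s≤s z≤n) k<N (i , j) in cons j e , u∈e , not-¬ refl

  extend-step : suc k ≤ N → Extendable (suc (suc k)) N → Extendable (suc (suc k)) (suc N)
  extend-step k<N E = record
    { colour    = extend colour (λ _ → spare)
    ; spare     = not spare
    ; proper    = extend-proper proper avoidable
    ; avoidable = extend-avoidable k<N colour spare
    }
    where open Extendable E

  -- On r + 1 parts (r = 3 + q): weight 1 on the edges meeting both parts 0 and 1, weight 2 on the others.
  -- Parts 0 and 1 then share one vertex sum S and every other part has a larger one; since r ≥ 3 and an
  -- edge misses only one part, every edge meets both kinds of parts.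
  module Base (q : ℕ) (z : Fin t) where

    colour₀ : Transversal (4 + q) → Bool
    colour₀ = extend (λ _ → true) (extend (λ _ → true) (λ _ → false))

    W₀ : Transversal (4 + q) → ℕ
    W₀ = weight ∘ colour₀

    W₁ : Transversal (3 + q) → ℕ
    W₁ = weight ∘ extend (λ _ → true) (λ _ → false)

    S : ℕ
    S = total (3 + q) (2 + q) W₁

    σ₀ : Vertex (4 + q) t → ℕ
    σ₀ u = degree (3 + q) u W₀

    part0 : ∀ j → σ₀ (zero , j) ≡ S
    part0 j = degree-head (2 + q) j W₀

    part1 : ∀ j → σ₀ (suc zero , j) ≡ S
    part1 j = begin
      σ₀ (suc zero , j)
        ≡⟨ degree-suc (2 + q) zero j W₀ ⟩
      degree (3 + q) (zero , j) (W₀ ∘ (nothing ∷_)) + sumFin (λ _ → degree (2 + q) (zero , j) W₁)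
        ≡⟨ cong₂ _+_ (degree-head (2 + q) j (W₀ ∘ (nothing ∷_)))
                     (sumMap-cong (λ _ → degree-head (1 + q) j W₁) (allFin t)) ⟩
      total (2 + q) (2 + q) (λ _ → 2) + sumFin (λ _ → total (2 + q) (1 + q) (λ _ → 1))
        ≡⟨ total-suc (1 + q) W₁ ⟨
      S ∎
      where open ≡-Reasoning

    later-parts : ∀ i j → S < σ₀ (suc (suc i) , j)
    later-parts i j = begin-strict
      S
        ≡⟨ total-suc (1 + q) W₁ ⟩
      total (2 + q) (2 + q) (λ _ → 2) + sumFin (λ _ → total (2 + q) (1 + q) (λ _ → 1))
        ≡⟨ cong (total (2 + q) (2 + q) (λ _ → 2) +_)
                (sumMap-cong (λ _ → total-split q (i , j) 1) (allFin t)) ⟩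
      total (2 + q) (2 + q) (λ _ → 2) + sumFin (λ _ → degree (2 + q) (i , j) (λ _ → 1) + rest)
        <⟨ +-monoʳ-< _ (sumMap-mono-< (λ _ → <⇒≤ more) (∈-allFin z) more) ⟩
      total (2 + q) (2 + q) (λ _ → 2) + sumFin (λ _ → degree (2 + q) (i , j) (λ _ → 2) + rest)
        ≡⟨ cong₂ _+_ (degree-regular (2 + q) (suc i , j) 2)
                     (sumMap-cong (λ _ → degree-suc (1 + q) i j W₁) (allFin t)) ⟨
      degree (3 + q) (suc i , j) (λ _ → 2) + sumFin (λ _ → degree (2 + q) (suc i , j) W₁)
        ≡⟨ degree-suc (2 + q) (suc i) j W₀ ⟨
      σ₀ (suc (suc i) , j) ∎
      where
      open ≤-Reasoning
      rest : ℕ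
      rest = sumFin (λ _ → degree (1 + q) (i , j) (λ _ → 1))
      more : degree (2 + q) (i , j) (λ _ → 1) + rest < degree (2 + q) (i , j) (λ _ → 2) + rest
      more = let e , u∈e = edge-through (s≤s z≤n) ≤-refl (i , j)
             in +-monoˡ-< rest (degree-< (λ _ → s≤s z≤n) e u∈e ≤-refl)

    proper₀ : ProperColouring {4 + q} {3 + q} {t} σ₀
    proper₀ (nothing ∷ v , |v|≡r) =
      let j₁ , u∈v = full-edge-head (v , |v|≡r)
          (i , j) , u′∈v = vertex-off-head (v , |v|≡r)
      in (suc zero , j₁) , (suc (suc i) , j) , u∈v , u′∈v ,
         <⇒≢ (≤-<-trans (≤-reflexive (part1 j₁)) (later-parts i j))
    proper₀ (just j₀ ∷ v , |v|≡r) =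
      let (i , j) , u′∈v = vertex-off-head (v , suc-injective |v|≡r)
      in (zero , j₀) , (suc (suc i) , j) , refl , u′∈v ,
         <⇒≢ (≤-<-trans (≤-reflexive (part0 j₀)) (later-parts i j))

    avoidable₀ : Avoidable (3 + q) colour₀ false
    avoidable₀ (zero  , j) = cons j (skip (edge-of-size ≤-refl j)) , refl , λ ()
    avoidable₀ (suc i , j) =
      let e , u∈e = edge-through (s≤s z≤n) ≤-refl (i , j) in skip e , u∈e , λ ()

    extendable₀ : Extendable (3 + q) (4 + q)
    extendable₀ = record { colour = colour₀ ; spare = false ; proper = proper₀ ; avoidable = avoidable₀ }

  extendable : 3 ≤ r → Fin t → r < N → Extendable r N
  extendable 3≤r@(s≤s (s≤s (s≤s _))) z (s≤s r≤N) with m≤n⇒m<n∨m≡n r≤N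
  ... | inj₁ r<N  = extend-step (≤-trans (n≤1+n _) (<⇒≤ r<N)) (extendable 3≤r z r<N)
  ... | inj₂ refl = Base.extendable₀ _ z

  ProperColouring-≗ : {C : Set} {c c′ : Vertex N t → C} → (∀ u → c u ≡ c′ u) →
                      ProperColouring {N} {r} {t} c → ProperColouring {N} {r} {t} c′
  ProperColouring-≗ c≗c′ proper e =
    let u , u′ , u∈e , u′∈e , cu≢cu′ = proper e
    in u , u′ , u∈e , u′∈e , λ eq → cu≢cu′ (trans (c≗c′ u) (trans eq (sym (c≗c′ u′))))

  has-proper-weighting : Extendable r N → HasProperWeighting N r t 2
  has-proper-weighting {r} E =
    w , (λ e → weight-false≤ (colour (proj₁ e)) , weight≤true (colour (proj₁ e))) ,
    ProperColouring-≗ (λ u → sym (σe≡degree w (weight ∘ colour) (λ _ → refl) u)) proper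
    where
    open Extendable E
    w : Edge _ r t → ℕ
    w e = weight (colour (proj₁ e))

r≤2[r∸1]² : 2 ≤ r → r ≤ 2 * ((r ∸ 1) * (r ∸ 1))
r≤2[r∸1]² {suc (suc m)} (s≤s (s≤s z≤n)) = begin
  suc (suc m)          ≤⟨ m<m*n (suc m) 2 ≤-refl ⟩
  suc m * 2            ≡⟨ *-comm (suc m) 2 ⟩
  2 * suc m            ≤⟨ *-monoʳ-≤ 2 (m≤m*n (suc m) (suc m)) ⟩
  2 * (suc m * suc m)  ∎
  where open ≤-Reasoning

theorem3p1 : (n r t : ℕ) → 3 ≤ r → 1 ≤ t → 2 * ((r ∸ 1) * (r ∸ 1)) < n →
    ChiE≡ n r t 2
theorem3p1 n r t 3≤r 1≤t 2[r∸1]²<n =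
  has-proper-weighting (extendable 3≤r j r<n) ,
  λ _ k<2 → no-proper-weighting-below-2 j (<⇒≤ r<n) k<2
  where
  open Transversals t using (no-proper-weighting-below-2)
  open Weighting t using (extendable; has-proper-weighting)
  j : Fin t
  j = fromℕ< 1≤t
  r<n : r < n
  r<n = ≤-<-trans (r≤2[r∸1]² (≤-trans (n≤1+n 2) 3≤r)) 2[r∸1]²<n
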